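{- Let $p \geq 5$ be a prime number and $V = (\mathbb{Z}/p^2\mathbb{Z})^2$. Let $\widetilde{G}$ be the subgroup of $\mathrm{GL}_2(\mathbb{Z}/p^2\mathbb{Z})$ generated by $$\sigma = \begin{pmatrix} 1+p & 1 \\ 2p & 1+p \end{pmatrix}, \quad h = \begin{pmatrix} 1+p & 0 \\ 0 & 1-p \end{pmatrix}.$$ Then $H^1_{\mathrm{loc}}(\widetilde{G}, V) \neq 0$.
   Context: $\widetilde{G}$ acts on $V$ by matrix multiplication. For a group $\Gamma$ and a $\Gamma$-module $M$, a cocycle $Z \colon \Gamma \to M$ satisfies the local conditions if for every $\gamma \in \Gamma$ there exists $m_\gamma \in M$ with $Z_\gamma = \gamma(m_\gamma) - m_\gamma$; $H^1_{\mathrm{loc}}(\Gamma, M)$ is the subgroup of $H^1(\Gamma, M)$ of classes of such cocycles. -}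

module Defs where

open import Data.Nat using (ℕ; _*_)
open import Data.Integer as ℤ using (ℤ; +_; -_; _-_)
open import Data.Integer.Divisibility using (_∣_)
open import Data.Product using (_×_; _,_; ∃)
open import Relation.Nullary using (¬_)

-- Elements of ℤ/Nℤ are represented by integers; equality is congruence mod N.
_≡[mod_]_ : ℤ → ℕ → ℤ → Set
a ≡[mod N ] b = (+ N) ∣ (a - b)

V : Set
V = ℤ × ℤ

-- 2×2 matrices ( a b ; c d ) over ℤ (reduced mod p² via the equalities below)
record Mat : Set where
  constructor mat
  field
    a b c d : ℤ
open Mat public

_·_ : Mat → Mat → Mat
mat a₁ b₁ c₁ d₁ · mat a₂ b₂ c₂ d₂ =
  mat (a₁ ℤ.* a₂ ℤ.+ b₁ ℤ.* c₂) (a₁ ℤ.* b₂ ℤ.+ b₁ ℤ.* d₂)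
      (c₁ ℤ.* a₂ ℤ.+ d₁ ℤ.* c₂) (c₁ ℤ.* b₂ ℤ.+ d₁ ℤ.* d₂)

_⋆_ : Mat → V → V
mat a₁ b₁ c₁ d₁ ⋆ (x , y) = (a₁ ℤ.* x ℤ.+ b₁ ℤ.* y , c₁ ℤ.* x ℤ.+ d₁ ℤ.* y)

_+V_ : V → V → V
(x , y) +V (x' , y') = (x ℤ.+ x' , y ℤ.+ y')

_-V_ : V → V → V
(x , y) -V (x' , y') = (x - x' , y - y')

_≈V[_]_ : V → ℕ → V → Set
(x , y) ≈V[ N ] (x' , y') = (x ≡[mod N ] x') × (y ≡[mod N ] y')

_≈M[_]_ : Mat → ℕ → Mat → Set
mat a₁ b₁ c₁ d₁ ≈M[ N ] mat a₂ b₂ c₂ d₂ =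
  (a₁ ≡[mod N ] a₂) × (b₁ ≡[mod N ] b₂) × (c₁ ≡[mod N ] c₂) × (d₁ ≡[mod N ] d₂)

module _ (p : ℕ) where
  private
    P : ℤ
    P = + p
    one : ℤ
    one = + 1

  N : ℕ
  N = p * p

  I₂ : Mat
  I₂ = mat one (+ 0) (+ 0) one

  σ : Mat
  σ = mat (one ℤ.+ P) one (+ 2 ℤ.* P) (one ℤ.+ P)

  -- inverse of σ mod p² (det σ = 1 + p² ≡ 1), i.e. its adjugate
  σ⁻¹ : Mat
  σ⁻¹ = mat (one ℤ.+ P) (- one) (- (+ 2 ℤ.* P)) (one ℤ.+ P)

  h : Mat
  h = mat (one ℤ.+ P) (+ 0) (+ 0) (one - P)

  -- inverse of h mod p² (det h = 1 - p² ≡ 1)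
  h⁻¹ : Mat
  h⁻¹ = mat (one - P) (+ 0) (+ 0) (one ℤ.+ P)

  data InG : Mat → Set where
    g-one : InG I₂
    g-σ   : InG σ
    g-σ⁻¹ : InG σ⁻¹
    g-h   : InG h
    g-h⁻¹ : InG h⁻¹
    g-mul : ∀ {A B} → InG A → InG B → InG (A · B)

  IsCocycle : (Mat → V) → Set
  IsCocycle Z =
    (∀ A B → InG A → A ≈M[ N ] B → Z A ≈V[ N ] Z B) ×
    (∀ A B → InG A → InG B → Z (A · B) ≈V[ N ] (Z A +V (A ⋆ Z B)))

  IsLocal : (Mat → V) → Set
  IsLocal Z = ∀ A → InG A → ∃ λ (m : V) → Z A ≈V[ N ] ((A ⋆ m) -V m)

  IsCoboundary : (Mat → V) → Set
  IsCoboundary Z = ∃ λ (m : V) → ∀ A → InG A → Z A ≈V[ N ] ((A ⋆ m) -V m)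

  H¹loc≢0 : Set
  H¹loc≢0 = ∃ λ (Z : Mat → V) → IsCocycle Z × IsLocal Z × ¬ IsCoboundary Z

module Submission where

open import Defs
open import Data.Nat using (ℕ; _≤_)
open import Data.Nat.Primality using (Prime)

import Data.Nat as ℕ
import Data.Nat.Properties as ℕP
import Data.Nat.Divisibility as ℕD
open import Data.Nat.Primality using (prime⇒irreducible)
open import Data.Nat.Coprimality using (Coprime; coprime-Bézout)
open import Data.Nat.GCD using (module Bézout)
open import Data.Integer using (ℤ; +_; -_; _-_; _+_; _*_; -[1+_])
import Data.Integer.Properties as ℤP
open import Data.Integer.Divisibility.Signed
open import Data.Integer.Tactic.RingSolver using (solve)
open import Data.List using (List; _∷_; [])
open import Data.Product using (_×_; _,_; ∃; proj₁; proj₂)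
open import Data.Sum using (inj₁; inj₂)
open import Function using (_∘_)
open import Relation.Nullary using (¬_; yes; no; contradiction)
open import Relation.Binary.PropositionalEquality using (_≡_; refl; sym; cong; subst; module ≡-Reasoning)

-- The cocycle is Z_A = (a − d, 0) for A = (a b ; c d).
--
-- Every element of G̃ has the normal form A = (1 + pα, b ; pγ, 1 + pj) with
-- γ ≡ 2b and α + j ≡ 2b² (mod p): the generators have this form and it is
-- closed under products.  Everything about normal forms is proved over ℤ with
-- p replaced by an arbitrary integer P, so that the ring solver applies;
-- congruences modulo P² are divisibilities of differences by P · P.  After
-- this setup and the normal form, the file proves in turn:
--  * cocycle:    on normal forms, Z_{AB} − Z_A − A Z_B ≡ 0 (mod P²);
--  * local:      if P ∣ b then Z_A = A m − m for m = (2, 0); if b is a unit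
--                modulo the prime p, with inverse u, take m = (0, p(α − j)u);
--  * nontrivial: a global m = (x, y) would satisfy the equations at h and σ,
--                whose combination gives p² ∣ 4p, i.e. p ∣ 4, impossible for p ≥ 5.
-- The theorem is the conjunction of these three facts.

infix 4 _∼[_]_ _∼V[_]_

_∼[_]_ : ℤ → ℤ → ℤ → Set
x ∼[ k ] y = k ∣ x - y

_∼V[_]_ : V → ℤ → V → Set
(x , y) ∼V[ k ] (x′ , y′) = x ∼[ k ] x′ × y ∼[ k ] y′

-- transport a divisibility along an equation; the argument order lets the
-- ring solver see both sides of the equation
divides-≡ : ∀ {k x y} → k ∣ x → x ≡ y → k ∣ y
divides-≡ k∣x refl = k∣x

∣0 : ∀ {k} → k ∣ + 0
∣0 = divides (+ 0) refl

P∣⇒P²∣P* : ∀ {P x} → P ∣ x → P * P ∣ P * x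
P∣⇒P²∣P* {P} = *-monoʳ-∣ P

∼⇒≡mod : ∀ {n} x y → x ∼[ + n ] y → x ≡[mod n ] y
∼⇒≡mod x y = ∣⇒∣ᵤ

≡mod⇒∼ : ∀ {n} x y → x ≡[mod n ] y → x ∼[ + n ] y
≡mod⇒∼ {n} x y = ∣ᵤ⇒∣ {+ n} {x - y}

p²-modulus : ∀ p → + N p ≡ + p * + p
p²-modulus p = ℤP.pos-* p p

∼V⇒≈V : ∀ p u v → u ∼V[ + p * + p ] v → u ≈V[ N p ] v
∼V⇒≈V p (x , y) (x′ , y′) (e₁ , e₂) =
  ∼⇒≡mod x x′ (subst (_∣ x - x′) (sym (p²-modulus p)) e₁) ,
  ∼⇒≡mod y y′ (subst (_∣ y - y′) (sym (p²-modulus p)) e₂)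

≈V⇒∼V : ∀ p u v → u ≈V[ N p ] v → u ∼V[ + p * + p ] v
≈V⇒∼V p (x , y) (x′ , y′) (e₁ , e₂) =
  subst (_∣ x - x′) (p²-modulus p) (≡mod⇒∼ x x′ e₁) ,
  subst (_∣ y - y′) (p²-modulus p) (≡mod⇒∼ y y′ e₂)

data Normal (P : ℤ) : Mat → Set where
  normal : ∀ {a b c d} α γ j →
           a ≡ + 1 + P * α → c ≡ P * γ → d ≡ + 1 + P * j →
           P ∣ γ - + 2 * b → P ∣ α + j - + 2 * b * b →
           Normal P (mat a b c d)

-- normal forms are closed under multiplication: the product has parameters
-- α = α₁ + α₂ + b₁γ₂ + Pα₁α₂, γ = γ₁ + γ₂ + P(γ₁α₂ + j₁γ₂), j = j₁ + j₂ + γ₁b₂ + Pj₁j₂,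
-- and both congruences follow from those of the factors by ring identities
normal-· : ∀ {P A B} → Normal P A → Normal P B → Normal P (A · B)
normal-· {P} (normal {b = b₁} α₁ γ₁ j₁ refl refl refl κ₁ δ₁)
             (normal {b = b₂} α₂ γ₂ j₂ refl refl refl κ₂ δ₂) =
  normal (α₁ + α₂ + b₁ * γ₂ + P * α₁ * α₂) (γ₁ + γ₂ + P * (γ₁ * α₂ + j₁ * γ₂))
         (j₁ + j₂ + γ₁ * b₂ + P * j₁ * j₂)
         (solve vs) (solve vs) (solve vs)
         (divides-≡ (∣m∣n⇒∣m+n (∣m∣n⇒∣m+n κ₁ κ₂) (P∣P* (γ₁ * α₂ + j₁ * γ₂ - + 2 * α₁ * b₂ - + 2 * b₁ * j₂)))
                    (solve vs))
         (divides-≡ (∣m∣n⇒∣m+n (∣m∣n⇒∣m+n (∣m∣n⇒∣m+n (∣m∣n⇒∣m+n δ₁ δ₂) (∣n⇒∣m*n b₁ κ₂)) (∣m⇒∣m*n b₂ κ₁))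
                                (P∣P* (α₁ * α₂ + j₁ * j₂ - + 4 * (b₁ + b₂) * (α₁ * b₂ + b₁ * j₂)
                                       - + 2 * P * (α₁ * b₂ + b₁ * j₂) * (α₁ * b₂ + b₁ * j₂))))
                    (solve vs))
  where
  vs : List ℤ
  vs = P ∷ α₁ ∷ b₁ ∷ γ₁ ∷ j₁ ∷ α₂ ∷ b₂ ∷ γ₂ ∷ j₂ ∷ []
  P∣P* : ∀ x → P ∣ P * x
  P∣P* x = ∣m⇒∣m*n x ∣-refl

I-normal : ∀ P → Normal P (mat (+ 1) (+ 0) (+ 0) (+ 1))
I-normal P = normal (+ 0) (+ 0) (+ 0) (solve (P ∷ [])) (solve (P ∷ [])) (solve (P ∷ [])) ∣0 ∣0

σ-normal : ∀ P → Normal P (mat (+ 1 + P) (+ 1) (+ 2 * P) (+ 1 + P))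
σ-normal P = normal (+ 1) (+ 2) (+ 1) (solve (P ∷ [])) (solve (P ∷ [])) (solve (P ∷ [])) ∣0 ∣0

σ⁻¹-normal : ∀ P → Normal P (mat (+ 1 + P) (- + 1) (- (+ 2 * P)) (+ 1 + P))
σ⁻¹-normal P = normal (+ 1) (- + 2) (+ 1) (solve (P ∷ [])) (solve (P ∷ [])) (solve (P ∷ [])) ∣0 ∣0

h-normal : ∀ P → Normal P (mat (+ 1 + P) (+ 0) (+ 0) (+ 1 - P))
h-normal P = normal (+ 1) (+ 0) (- + 1) (solve (P ∷ [])) (solve (P ∷ [])) (solve (P ∷ [])) ∣0 ∣0

h⁻¹-normal : ∀ P → Normal P (mat (+ 1 - P) (+ 0) (+ 0) (+ 1 + P))
h⁻¹-normal P = normal (- + 1) (+ 0) (+ 1) (solve (P ∷ [])) (solve (P ∷ [])) (solve (P ∷ [])) ∣0 ∣0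

InG⇒Normal : ∀ {p A} → InG p A → Normal (+ p) A
InG⇒Normal {p} g-one       = I-normal (+ p)
InG⇒Normal {p} g-σ         = σ-normal (+ p)
InG⇒Normal {p} g-σ⁻¹       = σ⁻¹-normal (+ p)
InG⇒Normal {p} g-h         = h-normal (+ p)
InG⇒Normal {p} g-h⁻¹       = h⁻¹-normal (+ p)
InG⇒Normal     (g-mul g g′) = normal-· (InG⇒Normal g) (InG⇒Normal g′)

Z : Mat → V
Z (mat a _ _ d) = (a - d , + 0)

Z-resp : ∀ {n} A B → A ≈M[ n ] B → Z A ≈V[ n ] Z B
Z-resp (mat a₁ _ _ d₁) (mat a₂ _ _ d₂) (a₁≡a₂ , _ , _ , d₁≡d₂) =
  ∼⇒≡mod (a₁ - d₁) (a₂ - d₂)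
    (divides-≡ (∣m∣n⇒∣m-n (≡mod⇒∼ a₁ a₂ a₁≡a₂) (≡mod⇒∼ d₁ d₂ d₁≡d₂)) (solve (a₁ ∷ a₂ ∷ d₁ ∷ d₂ ∷ []))) ,
  ∼⇒≡mod (+ 0) (+ 0) ∣0

-- the cocycle identity for Z at (A, B), written out in the entries of A and B
-- (a definitional unfolding, stated so that the ring solver sees the entries)
cocycle-in-entries : ∀ {k} a₁ b₁ c₁ d₁ a₂ b₂ c₂ d₂ →
  (a₁ * a₂ + b₁ * c₂) - (c₁ * b₂ + d₁ * d₂) ∼[ k ] (a₁ - d₁) + (a₁ * (a₂ - d₂) + b₁ * + 0) →
  + 0 ∼[ k ] + 0 + (c₁ * (a₂ - d₂) + d₁ * + 0) →
  Z (mat a₁ b₁ c₁ d₁ · mat a₂ b₂ c₂ d₂) ∼V[ k ] (Z (mat a₁ b₁ c₁ d₁) +V (mat a₁ b₁ c₁ d₁ ⋆ Z (mat a₂ b₂ c₂ d₂)))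
cocycle-in-entries _ _ _ _ _ _ _ _ e₁ e₂ = e₁ , e₂

-- the cocycle identity Z_{AB} = Z_A + A Z_B modulo P² on normal forms; the first
-- coordinate of the defect is P(b₁γ₂ − γ₁b₂) + P²(…), and b₁γ₂ − γ₁b₂ ≡ 0 (mod P)
Z-cocycle : ∀ {P A B} → Normal P A → Normal P B → Z (A · B) ∼V[ P * P ] (Z A +V (A ⋆ Z B))
Z-cocycle {P} (normal {a₁} {b₁} {c₁} {d₁} α₁ γ₁ j₁ refl refl refl κ₁ _)
              (normal {a₂} {b₂} {c₂} {d₂} α₂ γ₂ j₂ refl refl refl κ₂ _) =
  cocycle-in-entries {P * P} a₁ b₁ c₁ d₁ a₂ b₂ c₂ d₂
    (divides-≡ (∣m∣n⇒∣m+n (P∣⇒P²∣P* (∣m∣n⇒∣m-n (∣n⇒∣m*n b₁ κ₂) (∣m⇒∣m*n b₂ κ₁)))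
                          (∣n⇒∣m*n ((α₁ - j₁) * j₂) ∣-refl))
               (solve vs))
    (divides (- (γ₁ * (α₂ - j₂))) (solve vs))
  where
  vs : List ℤ
  vs = P ∷ α₁ ∷ b₁ ∷ γ₁ ∷ j₁ ∷ α₂ ∷ b₂ ∷ γ₂ ∷ j₂ ∷ []

Z-is-cocycle : ∀ p → IsCocycle p Z
Z-is-cocycle p =
  (λ A B _ → Z-resp A B) ,
  (λ A B g g′ → ∼V⇒≈V p (Z (A · B)) (Z A +V (A ⋆ Z B)) (Z-cocycle (InG⇒Normal g) (InG⇒Normal g′)))

CoboundaryAt : ℤ → Mat → Set
CoboundaryAt k A = ∃ λ m → Z A ∼V[ k ] ((A ⋆ m) -V m)

-- the condition Z_A ≡ A m − m, written out in the entries of A and m = (x, y)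
-- (a definitional unfolding, for the same reason)
coboundary-in-entries : ∀ {k} a b c d x y →
  a - d ∼[ k ] (a * x + b * y) - x → + 0 ∼[ k ] (c * x + d * y) - y →
  Z (mat a b c d) ∼V[ k ] ((mat a b c d ⋆ (x , y)) -V (x , y))
coboundary-in-entries _ _ _ _ _ _ e₁ e₂ = e₁ , e₂

-- if P ∣ b then m = (2, 0) works: modulo P², c ≡ 0 and a + d ≡ 2 + 2Pb² ≡ 2
coboundaryAt-P∣b : ∀ {P A} → Normal P A → P ∣ Mat.b A → CoboundaryAt (P * P) A
coboundaryAt-P∣b {P} (normal {a} {_} {c} {d} α γ j refl refl refl κ δ) (divides q refl) =
  (+ 2 , + 0) ,
  coboundary-in-entries {P * P} a (q * P) c d (+ 2) (+ 0)
    (divides-≡ (∣m∣n⇒∣m-n (∣m⇒∣-m (P∣⇒P²∣P* δ)) (∣n⇒∣m*n (+ 2 * q * q * P) ∣-refl)) (solve vs))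
    (divides-≡ (∣m∣n⇒∣m-n (∣m⇒∣-m (P∣⇒P²∣P* (∣n⇒∣m*n (+ 2) κ))) (∣n⇒∣m*n (+ 4 * q) ∣-refl)) (solve vs))
  where
  vs : List ℤ
  vs = P ∷ α ∷ q ∷ γ ∷ j ∷ []

coboundaryAt-unit : ∀ {P A u} → Normal P A → P ∣ Mat.b A * u - + 1 → CoboundaryAt (P * P) A
coboundaryAt-unit {P} {u = u} (normal {a} {b} {c} {d} α γ j refl refl refl _ _) bu≡1 =
  (+ 0 , P * (α - j) * u) ,
  coboundary-in-entries {P * P} a b c d (+ 0) (P * (α - j) * u)
    (divides-≡ (∣m⇒∣-m (P∣⇒P²∣P* (∣n⇒∣m*n (α - j) bu≡1))) (solve vs))
    (divides (- (j * (α - j) * u)) (solve vs))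
  where
  vs : List ℤ
  vs = P ∷ α ∷ b ∷ γ ∷ j ∷ u ∷ []

prime∤⇒coprime : ∀ {p n} → Prime p → ¬ (p ℕD.∣ n) → Coprime p n
prime∤⇒coprime p-prime p∤n (d∣p , d∣n) with prime⇒irreducible p-prime d∣p
... | inj₁ d≡1  = d≡1
... | inj₂ refl = contradiction d∣n p∤n

ℕ-eq⇒ℤ-eq : ∀ a b c d e → a ℕ.+ b ℕ.* c ≡ d ℕ.* e → + a + + b * + c ≡ + d * + e
ℕ-eq⇒ℤ-eq a b c d e eq = begin
  + a + + b * + c     ≡⟨ cong (_+_ (+ a)) (sym (ℤP.pos-* b c)) ⟩
  + a + + (b ℕ.* c)   ≡⟨ sym (ℤP.pos-+ a (b ℕ.* c)) ⟩
  + (a ℕ.+ b ℕ.* c)   ≡⟨ cong +_ eq ⟩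
  + (d ℕ.* e)         ≡⟨ ℤP.pos-* d e ⟩
  + d * + e           ∎
  where open ≡-Reasoning

inverse-from-+- : ∀ p n x y → + 1 + y * n ≡ x * p → p ∣ n * - y - + 1
inverse-from-+- p n x y eq = divides (- x) (begin
  n * - y - + 1     ≡⟨ solve (n ∷ y ∷ []) ⟩
  - (+ 1 + y * n)   ≡⟨ cong -_ eq ⟩
  - (x * p)         ≡⟨ solve (x ∷ p ∷ []) ⟩
  - x * p           ∎)
  where open ≡-Reasoning

inverse-from-−+ : ∀ p n x y → + 1 + x * p ≡ y * n → p ∣ n * y - + 1
inverse-from-−+ p n x y eq = divides x (begin
  n * y - + 1          ≡⟨ solve (n ∷ y ∷ []) ⟩
  y * n - + 1          ≡⟨ cong (_- + 1) (sym eq) ⟩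
  + 1 + x * p - + 1    ≡⟨ solve (x ∷ p ∷ []) ⟩
  x * p                ∎)
  where open ≡-Reasoning

inverse-neg : ∀ {k b u} → k ∣ b * u - + 1 → k ∣ (- b) * (- u) - + 1
inverse-neg {b = b} {u} k∣bu-1 = divides-≡ k∣bu-1 (solve (b ∷ u ∷ []))

ℕ-inverse-mod-prime : ∀ {p n} → Prime p → ¬ (p ℕD.∣ n) → ∃ λ v → + p ∣ + n * v - + 1
ℕ-inverse-mod-prime {p} {n} p-prime p∤n with coprime-Bézout (prime∤⇒coprime p-prime p∤n)
... | Bézout.+- x y eq = - + y , inverse-from-+- (+ p) (+ n) (+ x) (+ y) (ℕ-eq⇒ℤ-eq 1 y n x p eq)
... | Bézout.-+ x y eq = + y , inverse-from-−+ (+ p) (+ n) (+ x) (+ y) (ℕ-eq⇒ℤ-eq 1 x p y n eq)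

inverse-mod-prime : ∀ {p b} → Prime p → ¬ (+ p ∣ b) → ∃ λ u → + p ∣ b * u - + 1
inverse-mod-prime {b = + n} p-prime p∤b = ℕ-inverse-mod-prime p-prime (p∤b ∘ ∣ᵤ⇒∣)
inverse-mod-prime {b = -[1+ n ]} p-prime p∤b with ℕ-inverse-mod-prime p-prime (p∤b ∘ ∣ᵤ⇒∣)
... | v , p∣nv-1 = - v , inverse-neg {b = + ℕ.suc n} {u = v} p∣nv-1

coboundaryAt⇒local : ∀ p {A} → CoboundaryAt (+ p * + p) A → ∃ λ m → Z A ≈V[ N p ] ((A ⋆ m) -V m)
coboundaryAt⇒local p {A} (m , e) = m , ∼V⇒≈V p (Z A) ((A ⋆ m) -V m) e

Z-local : ∀ {p} → Prime p → IsLocal p Z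
Z-local {p} p-prime A g with + p ∣? Mat.b A
... | yes p∣b = coboundaryAt⇒local p {A} (coboundaryAt-P∣b (InG⇒Normal g) p∣b)
... | no p∤b  = coboundaryAt⇒local p {A} (coboundaryAt-unit (InG⇒Normal g) (proj₂ (inverse-mod-prime p-prime p∤b)))

-- the equations Z_g ≡ g m − m for m = (x, y) at g = h (first coordinate) and
-- g = σ say P(2 − x) ≡ 0, −(Px + y) ≡ 0 and −P(2x + y) ≡ 0 modulo P²;
-- twice the first, minus the third, plus P times the second is 4P
coboundary-obstruction : ∀ P x y →
  (+ 1 + P) - (+ 1 - P) ∼[ P * P ] ((+ 1 + P) * x + + 0 * y) - x →
  (+ 1 + P) - (+ 1 + P) ∼[ P * P ] ((+ 1 + P) * x + + 1 * y) - x →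
  + 0 ∼[ P * P ] (+ 2 * P * x + (+ 1 + P) * y) - y →
  P * P ∣ P * + 4
coboundary-obstruction P x y at-h at-σ₁ at-σ₂ =
  divides-≡ (∣m∣n⇒∣m+n (∣m∣n⇒∣m-n (∣m∣n⇒∣m+n (∣n⇒∣m*n (+ 2) at-h) (∣n⇒∣m*n x ∣-refl)) at-σ₂)
                       (∣n⇒∣m*n P at-σ₁))
            (solve (P ∷ x ∷ y ∷ []))

Z-not-coboundary : ∀ {p} .{{_ : ℕ.NonZero p}} → ¬ (p ℕD.∣ 4) → ¬ IsCoboundary p Z
Z-not-coboundary {p} p∤4 ((x , y) , is-coboundary) =
  p∤4 (∣⇒∣ᵤ (*-cancelˡ-∣ (+ p) (coboundary-obstruction (+ p) x y
        (proj₁ (at (h p) g-h)) (proj₁ (at (σ p) g-σ)) (proj₂ (at (σ p) g-σ)))))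
  where
  at : ∀ g → InG p g → Z g ∼V[ + p * + p ] ((g ⋆ (x , y)) -V (x , y))
  at g g∈G̃ = ≈V⇒∼V p (Z g) ((g ⋆ (x , y)) -V (x , y)) (is-coboundary g g∈G̃)

corollary13 : (p : ℕ) → Prime p → 5 ≤ p → H¹loc≢0 p
corollary13 p p-prime 5≤p = Z , Z-is-cocycle p , Z-local p-prime , Z-not-coboundary p∤4
  where
  instance
    p≢0 : ℕ.NonZero p
    p≢0 = ℕ.>-nonZero (ℕP.<-trans (ℕ.s≤s ℕ.z≤n) 5≤p)
  p∤4 : ¬ (p ℕD.∣ 4)
  p∤4 p∣4 = ℕP.<⇒≱ 5≤p (ℕD.∣⇒≤ p∣4)
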